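{- Let $w$ be a word and $i$ a positive integer such that $s_1(w)=s_2(w)=\cdots=s_i(w)=2$ and $|SQ_1|=|SQ_2|=\cdots=|SQ_i|$. Write $sq_1=(x_1x_2)^{p_1}x_1$ and $SQ_1=(x_1x_2)^{p_1}x_1(x_1x_2)^{p_2}$ with $x_1,x_2$ nonempty, $x_1x_2$ primitive, and $p_1\ge p_2\ge0$. Then $i\le |lcp(x_1x_2,x_2x_1)|+1$ if $p_1>p_2$, and $i\le \min(|lcp(x_1x_2,x_2x_1)|+1,|x_1|)$ otherwise.
   Context: A square is a word $uu$ with $u$ nonempty; $u$ is its root. A square $uu$ occurs at location $k$ of $w=a_1\cdots a_n$ if $a_k\cdots a_{k+2|u|-1}=uu$. $s_k(w)$ is the number of distinct squares occurring at location $k$ of $w$ but at no location $k'>k$; it is known that $s_k(w)\le2$. When $s_k(w)=2$, the two such squares are $sq_k^2$, $SQ_k^2$ with $|sq_k|<|SQ_k|$. It is known that for $k$ with $s_k(w)=2$ there exist nonempty $x_1,x_2$ with $x_1x_2$ primitive and integers $p_1\ge p_2\ge0$ with $sq_k=(x_1x_2)^{p_1}x_1$ and $SQ_k=(x_1x_2)^{p_1}x_1(x_1x_2)^{p_2}$. $lcp(u,v)$ denotes the longest common prefix of $u$ and $v$. -}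

module Defs where

open import Data.Nat using (ℕ; zero; suc; _≤_; _<_; _∸_)
open import Data.List using (List; []; _∷_; _++_; drop; length)
open import Data.Product using (_×_; ∃; ∃-syntax)
open import Data.Sum using (_⊎_)
open import Relation.Nullary using (¬_; yes; no)
open import Relation.Binary.PropositionalEquality using (_≡_; _≢_)
open import Relation.Binary.Definitions using (DecidableEquality)

module _ {A : Set} where

  _^w_ : List A → ℕ → List A
  u ^w zero  = []
  u ^w suc n = u ++ (u ^w n)

  Primitive : List A → Set
  Primitive x = x ≢ [] × (∀ (y : List A) (n : ℕ) → 2 ≤ n → x ≢ y ^w n)

  -- the square u u (root u, u nonempty) occurs at (1-based) location k of w,
  -- i.e. a_k ⋯ a_{k+2|u|-1} = u u
  OccursAt : List A → ℕ → List A → Set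
  OccursAt w k u = 1 ≤ k × u ≢ [] × ∃[ v ] drop (k ∸ 1) w ≡ u ++ u ++ v

  NewAt : List A → ℕ → List A → Set
  NewAt w k u = OccursAt w k u × (∀ k' → k < k' → ¬ OccursAt w k' u)

  -- s_k(w) = 2, with sq_k = u and SQ_k = v (|u| < |v|):
  -- exactly two distinct squares (equivalently roots) are new at location k,
  -- namely u u and v v.
  TwoSquaresAt : List A → ℕ → List A → List A → Set
  TwoSquaresAt w k u v =
    NewAt w k u × NewAt w k v × length u < length v ×
    (∀ z → NewAt w k z → z ≡ u ⊎ z ≡ v)

  lcp : DecidableEquality A → List A → List A → List A
  lcp _≟_ (a ∷ as) (b ∷ bs) with a ≟ b
  ... | yes _ = a ∷ lcp _≟_ as bs
  ... | no  _ = []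
  lcp _≟_ _ _ = []

{-# OPTIONS --safe #-}
-- Write X = x₁x₂, Y = x₂x₁, m = |X|, S = |sq₁| = p₁m + |x₁|, L = |SQ₁| = S + p₂m and
-- ℓ = |lcp(X, Y)|, which is < m because X is primitive. Since SQ₁SQ₁ = X^p₁ x₁ X^(p₂+p₁) x₁ X^p₂,
-- the word w agrees with the infinite word cyc = X^ω on its first S + ℓ letters, and its L + ℓ letters
-- from position S on agree with X^ω as well; at position S + ℓ the first agreement breaks,
-- because X^ω and Y^ω first differ at ℓ.
--
-- If p₁ = p₂, the equal-length squares SQ_k at locations 1, …, i make w L-periodic far enough to
-- repeat sq₁sq₁ at location L + 1 as soon as i > |x₁|, contradicting that sq₁sq₁ is new at 1.
--
-- If i ≥ ℓ + 2, let uu = sq_{ℓ+2}; newness forces |u| > L/2. Comparing the two halves of uu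
-- against the two X^ω-windows shows that X^ω has a period e with |u| = S + e or S = |u| + e,
-- so m ∣ e by primitivity. Through the square, the mismatch of X^ω and Y^ω at ℓ then becomes
-- an agreement: directly if |u| ≥ S, and if |u| < S by letting the shift by |x₁| run through
-- all residues modulo m.
module Submission where

open import Defs
open import Data.Nat using (ℕ; _≤_; _<_; _+_; _⊓_)
open import Data.List using (List; []; _++_; length)
open import Data.Product using (_×_)
open import Relation.Binary.PropositionalEquality using (_≡_; _≢_)
open import Relation.Binary.Definitions using (DecidableEquality)

open import Data.Nat
  using (zero; suc; pred; _*_; _∸_; z≤n; s≤s; z<s; s<s; NonZero; >-nonZero; >-nonZero⁻¹; _≤?_; _<?_)
open import Data.Nat.Properties
open import Data.Nat.DivMod using (_%_; _/_; m≡m%n+[m/n]*n; m%n<n; m<n⇒m%n≡m; [m+n]%n≡m%n)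
open import Data.Nat.Divisibility using (_∣_; divides; m%n≡0⇒n∣m; ∣⇒≤)
open import Data.Nat.Induction using (<-wellFounded)
open import Data.Nat.Tactic.RingSolver using (solve-∀)
open import Data.List using (_∷_; drop; take)
open import Data.List.Properties
  using (length-++; length-++-≤ˡ; ++-assoc; ++-identityʳ; ∷-injective; length-take; take++drop≡id)
open import Data.Maybe using (Maybe; just; nothing)
open import Data.Maybe.Properties using (just-injective)
open import Data.Product using (∃-syntax; _,_; proj₁; proj₂)
open import Data.Sum using (_⊎_; inj₁; inj₂)
open import Data.Empty using (⊥; ⊥-elim)
open import Function using (_∘_)
open import Induction.WellFounded using (Acc; acc)
open import Relation.Nullary using (¬_; Dec; yes; no)
open import Relation.Binary.PropositionalEquality
  using (refl; sym; trans; cong; cong₂; subst; subst₂; module ≡-Reasoning)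

open ≡-Reasoning

module _ {A : Set} where

  -- Positions are 0-based: location k in the sense of OccursAt is position k ∸ 1.
  infix 8 _!_

  _!_ : List A → ℕ → Maybe A
  []       ! _     = nothing
  (x ∷ xs) ! zero  = just x
  (x ∷ xs) ! suc t = xs ! t

  !-++ˡ : ∀ (xs ys : List A) {t} → t < length xs → (xs ++ ys) ! t ≡ xs ! t
  !-++ˡ (x ∷ xs) ys {zero}  _        = refl
  !-++ˡ (x ∷ xs) ys {suc t} (s<s t<) = !-++ˡ xs ys t<

  !-++ʳ : ∀ (xs ys : List A) t → (xs ++ ys) ! (length xs + t) ≡ ys ! t
  !-++ʳ []       ys t = refl
  !-++ʳ (x ∷ xs) ys t = !-++ʳ xs ys t

  !-drop : ∀ n (xs : List A) t → drop n xs ! t ≡ xs ! (n + t)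
  !-drop zero    xs       t = refl
  !-drop (suc n) []       t = refl
  !-drop (suc n) (x ∷ xs) t = !-drop n xs t

  !-prefix : ∀ (u xs : List A) → (∀ t → t < length u → xs ! t ≡ u ! t) →
             xs ≡ u ++ drop (length u) xs
  !-prefix []      xs       _ = refl
  !-prefix (c ∷ u) []       h with () ← h 0 z<s
  !-prefix (c ∷ u) (d ∷ xs) h =
    cong₂ _∷_ (just-injective (h 0 z<s)) (!-prefix u xs (λ t t< → h (suc t) (s<s t<)))

  !-ext : ∀ (xs ys : List A) → length xs ≡ length ys →
          (∀ t → t < length xs → xs ! t ≡ ys ! t) → xs ≡ ys
  !-ext []       []       _   _ = refl
  !-ext (x ∷ xs) (y ∷ ys) len h =
    cong₂ _∷_ (just-injective (h 0 z<s))
              (!-ext xs ys (suc-injective len) (λ t t< → h (suc t) (s<s t<)))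

  length-^w : ∀ (z : List A) n → length (z ^w n) ≡ n * length z
  length-^w z zero    = refl
  length-^w z (suc n) = trans (length-++ z) (cong (length z +_) (length-^w z n))

  ^w-+ : ∀ (z : List A) i j → z ^w (i + j) ≡ z ^w i ++ z ^w j
  ^w-+ z zero    j = refl
  ^w-+ z (suc i) j = trans (cong (z ++_) (^w-+ z i j)) (sym (++-assoc z (z ^w i) (z ^w j)))

  ++-split : ∀ (xs ys zs ws : List A) → xs ++ ys ≡ zs ++ ws → length xs ≤ length zs →
             ∃[ r ] zs ≡ xs ++ r × ys ≡ r ++ ws
  ++-split []       ys zs       ws eq _            = zs , refl , eq
  ++-split (x ∷ xs) ys (z ∷ zs) ws eq (s≤s xs≤zs) with ∷-injective eq
  ... | refl , eq′ with ++-split xs ys zs ws eq′ xs≤zs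
  ...   | r , zs≡ , ys≡ = r , cong (x ∷_) zs≡ , ys≡

  commute⇒powers : ∀ (u v : List A) → u ++ v ≡ v ++ u →
                   ∃[ z ] ∃[ i ] ∃[ j ] u ≡ z ^w i × v ≡ z ^w j
  commute⇒powers u v = go u v (<-wellFounded (length u + length v))
    where
    shorter : ∀ (u v r : List A) → v ≡ u ++ r → 0 < length u → length r < length v
    shorter u v r v≡ur 0<u =
      subst (length r <_) (sym (trans (cong length v≡ur) (length-++ u))) (m<n+m (length r) 0<u)

    go : ∀ (u v : List A) → Acc _<_ (length u + length v) → u ++ v ≡ v ++ u →
         ∃[ z ] ∃[ i ] ∃[ j ] u ≡ z ^w i × v ≡ z ^w j
    go []         v          _         _     = v , 0 , 1 , refl , sym (++-identityʳ v)
    go u@(_ ∷ _)  []         _         _     = u , 1 , 0 , sym (++-identityʳ u) , refl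
    go u@(_ ∷ _)  v@(_ ∷ _)  (acc rec) uv≡vu with ≤-total (length u) (length v)
    ... | inj₁ u≤v =
      let r , v≡ur , v≡ru   = ++-split u v v u uv≡vu u≤v
          z , i , j , u≡ , r≡ = go u r (rec (+-monoʳ-< (length u) (shorter u v r v≡ur z<s)))
                                      (trans (sym v≡ur) v≡ru)
      in z , i , i + j , u≡ , trans v≡ur (trans (cong₂ _++_ u≡ r≡) (sym (^w-+ z i j)))
    ... | inj₂ v≤u =
      let r , u≡vr , u≡rv   = ++-split v u u v (sym uv≡vu) v≤u
          z , i , j , r≡ , v≡ = go r v (rec (+-monoˡ-< (length v) (shorter v u r u≡vr z<s)))
                                      (trans (sym u≡rv) u≡vr)
      in z , j + i , j , trans u≡vr (trans (cong₂ _++_ v≡ r≡) (sym (^w-+ z j i))) , v≡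

  commute⇒¬primitive : ∀ {u v} → u ≢ [] → v ≢ [] → u ++ v ≡ v ++ u → ¬ Primitive (u ++ v)
  commute⇒¬primitive {u} {v} u≢[] v≢[] uv≡vu (_ , prim) with commute⇒powers u v uv≡vu
  ... | z , zero  , j     , refl , _    = u≢[] refl
  ... | z , suc i , zero  , _    , refl = v≢[] refl
  ... | z , suc i , suc j , refl , refl =
    prim z (suc i + suc j) (s≤s (≤-trans (s≤s z≤n) (m≤n+m (suc j) i)))
         (sym (^w-+ z (suc i) (suc j)))

  primitive⇒rotation≢ : ∀ {u v} → Primitive (u ++ v) → u ≢ [] → v ≢ [] → v ++ u ≢ u ++ v
  primitive⇒rotation≢ prim u≢[] v≢[] vu≡uv = commute⇒¬primitive u≢[] v≢[] (sym vu≡uv) prim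

  length-nonZero : ∀ {xs : List A} → xs ≢ [] → NonZero (length xs)
  length-nonZero {[]}    xs≢[] = ⊥-elim (xs≢[] refl)
  length-nonZero {_ ∷ _} _     = _

Period : {B : Set} → (ℕ → B) → ℕ → Set
Period g e = ∀ y → g (y + e) ≡ g y

module Periodic {B : Set} (g : ℕ → B) {m : ℕ} .{{_ : NonZero m}} (period : Period g m) where

  period-* : ∀ q → Period g (q * m)
  period-* zero    y = cong g (+-identityʳ y)
  period-* (suc q) y = begin
    g (y + (m + q * m)) ≡⟨ cong g (sym (+-assoc y m (q * m))) ⟩
    g (y + m + q * m)   ≡⟨ period-* q (y + m) ⟩
    g (y + m)           ≡⟨ period y ⟩
    g y                 ∎

  period-∣ : ∀ {e} → m ∣ e → Period g e
  period-∣ (divides q refl) = period-* q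

  period-% : ∀ x d → g (x + d % m) ≡ g (x + d)
  period-% x d = begin
    g (x + d % m)                 ≡⟨ sym (period-* (d / m) (x + d % m)) ⟩
    g (x + d % m + (d / m) * m)   ≡⟨ cong g (+-assoc x (d % m) _) ⟩
    g (x + (d % m + (d / m) * m)) ≡⟨ cong (λ n → g (x + n)) (sym (m≡m%n+[m/n]*n d m)) ⟩
    g (x + d)                     ∎

  -- Agreement with the shift by e on m consecutive positions covers every residue class.
  window⇒period : ∀ c e → (∀ t → t < m → g (c + t + e) ≡ g (c + t)) → Period g e
  window⇒period c e window y = begin
    g (y + e)             ≡⟨ sym (period-* c (y + e)) ⟩
    g (y + e + c * m)     ≡⟨ cong g (rearrange y e (c * m)) ⟩
    g (y + c * m + e)     ≡⟨ cong (λ n → g (n + e)) (sym c+d≡y+cm) ⟩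
    g (c + d + e)         ≡⟨ cong g (rearrange c d e) ⟩
    g (c + e + d)         ≡⟨ sym (period-% (c + e) d) ⟩
    g (c + e + d % m)     ≡⟨ cong g (rearrange c e (d % m)) ⟩
    g (c + d % m + e)     ≡⟨ window (d % m) (m%n<n d m) ⟩
    g (c + d % m)         ≡⟨ period-% c d ⟩
    g (c + d)             ≡⟨ cong g c+d≡y+cm ⟩
    g (y + c * m)         ≡⟨ period-* c y ⟩
    g y                   ∎
    where
    d = y + c * m ∸ c
    c+d≡y+cm : c + d ≡ y + c * m
    c+d≡y+cm = m+[n∸m]≡n (≤-trans (m≤m*n c m) (m≤n+m (c * m) y))
    rearrange : ∀ x y z → x + y + z ≡ x + z + y
    rearrange = solve-∀

  -- The window covers every residue class except that of c; following the orbit c + e, c + 2e, …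
  -- until it returns to the class of c carries the value at c + e along to the value at c.
  window⇒agree : ∀ c e → (∀ t → t < m ∸ 1 → g (suc c + t + e) ≡ g (suc c + t)) →
                 g (c + e) ≡ g c
  window⇒agree c e window = closed (orbit (m ∸ 1))
    where
    rearrange : ∀ x y z → x + y + z ≡ x + z + y
    rearrange = solve-∀

    off-c : ∀ d t → d % m ≡ suc t → g (c + d + e) ≡ g (c + d)
    off-c d t d%m≡ = begin
      g (c + d + e)       ≡⟨ cong g (rearrange c d e) ⟩
      g (c + e + d)       ≡⟨ sym (period-% (c + e) d) ⟩
      g (c + e + d % m)   ≡⟨ cong (λ n → g (c + e + n)) d%m≡ ⟩
      g (c + e + suc t)   ≡⟨ cong g (shift c e t) ⟩
      g (suc c + t + e)   ≡⟨ window t (∸-monoˡ-≤ 1 (subst (_< m) d%m≡ (m%n<n d m))) ⟩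
      g (suc c + t)       ≡⟨ cong g (sym (+-suc c t)) ⟩
      g (c + suc t)       ≡⟨ cong (λ n → g (c + n)) (sym d%m≡) ⟩
      g (c + d % m)       ≡⟨ period-% c d ⟩
      g (c + d)           ∎
      where shift : ∀ c e t → c + e + suc t ≡ suc c + t + e
            shift = solve-∀

    orbit : ∀ n → g (c + e) ≡ g c ⊎ g (c + e) ≡ g (c + suc n * e)
    orbit zero    = inj₂ (cong (λ n → g (c + n)) (sym (+-identityʳ e)))
    orbit (suc n) with orbit n | (suc n * e) % m in d%m≡
    ... | inj₁ returned | _     = inj₁ returned
    ... | inj₂ p        | zero  = inj₁ (trans p (period-∣ (m%n≡0⇒n∣m _ m d%m≡) c))
    ... | inj₂ p        | suc t = inj₂ (begin
      g (c + e)                   ≡⟨ p ⟩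
      g (c + suc n * e)           ≡⟨ sym (off-c (suc n * e) t d%m≡) ⟩
      g (c + suc n * e + e)       ≡⟨ cong g (+-assoc c _ e) ⟩
      g (c + (suc n * e + e))     ≡⟨ cong (λ n → g (c + n)) (+-comm (suc n * e) e) ⟩
      g (c + suc (suc n) * e)     ∎)

    closed : g (c + e) ≡ g c ⊎ g (c + e) ≡ g (c + suc (m ∸ 1) * e) → g (c + e) ≡ g c
    closed (inj₁ returned) = returned
    closed (inj₂ p) = begin
      g (c + e)                 ≡⟨ p ⟩
      g (c + suc (m ∸ 1) * e)   ≡⟨ cong (λ n → g (c + n * e)) (suc-pred m) ⟩
      g (c + m * e)             ≡⟨ cong (λ n → g (c + n)) (*-comm m e) ⟩
      g (c + e * m)             ≡⟨ period-* e c ⟩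
      g c                       ∎

module Cyclic {A : Set} (X : List A) .{{_ : NonZero (length X)}} where

  cyc : ℕ → Maybe A
  cyc y = X ! (y % length X)

  cyc-period : Period cyc (length X)
  cyc-period y = cong (X !_) ([m+n]%n≡m%n y (length X))

  open Periodic cyc cyc-period public

  cyc-< : ∀ {y} → y < length X → cyc y ≡ X ! y
  cyc-< y< = cong (X !_) (m<n⇒m%n≡m y<)

  !-^w++ : ∀ n v → (∀ t → t < length v → v ! t ≡ cyc t) →
           ∀ t → t < n * length X + length v → (X ^w n ++ v) ! t ≡ cyc t
  !-^w++ zero    v v≈cyc t t< = v≈cyc t t<
  !-^w++ (suc n) v v≈cyc t t< = trans (cong (_! t) (++-assoc X (X ^w n) v)) (split t t<)
    where
    split : ∀ t → t < length X + n * length X + length v → (X ++ (X ^w n ++ v)) ! t ≡ cyc t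
    split t t< with t <? length X
    ... | yes t<m = trans (!-++ˡ X _ t<m) (sym (cyc-< t<m))
    ... | no  t≮m with m≤n⇒∃[o]m+o≡n (≮⇒≥ t≮m)
    ...   | t′ , refl = begin
      (X ++ (X ^w n ++ v)) ! (length X + t′) ≡⟨ !-++ʳ X _ t′ ⟩
      (X ^w n ++ v) ! t′                     ≡⟨ !-^w++ n v v≈cyc t′ t′< ⟩
      cyc t′                                 ≡⟨ sym (cyc-period t′) ⟩
      cyc (t′ + length X)                    ≡⟨ cong cyc (+-comm t′ (length X)) ⟩
      cyc (length X + t′)                    ∎
      where t′< = +-cancelˡ-< (length X) t′ _ (subst (length X + t′ <_) (+-assoc (length X) _ _) t<)

  !-^w : ∀ n t → t < n * length X → (X ^w n) ! t ≡ cyc t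
  !-^w n t t< = begin
    (X ^w n) ! t      ≡⟨ cong (_! t) (sym (++-identityʳ (X ^w n))) ⟩
    (X ^w n ++ []) ! t ≡⟨ !-^w++ n [] (λ _ ()) t (subst (t <_) (sym (+-identityʳ _)) t<) ⟩
    cyc t             ∎

  !-rotation : ∀ u v → u ++ v ≡ X → ∀ t → t < length X → (v ++ u) ! t ≡ cyc (length u + t)
  !-rotation u v uv≡X t t<m with t <? length v
  ... | yes t<v = begin
    (v ++ u) ! t              ≡⟨ !-++ˡ v u t<v ⟩
    v ! t                     ≡⟨ sym (!-++ʳ u v t) ⟩
    (u ++ v) ! (length u + t) ≡⟨ cong (_! (length u + t)) uv≡X ⟩
    X ! (length u + t)        ≡⟨ sym (cyc-< u+t<m) ⟩
    cyc (length u + t)        ∎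
    where
    |X| = trans (cong length (sym uv≡X)) (length-++ u)
    u+t<m = subst (length u + t <_) (sym |X|) (+-monoʳ-< (length u) t<v)
  ... | no  t≮v with m≤n⇒∃[o]m+o≡n (≮⇒≥ t≮v)
  ...   | t′ , refl = begin
    (v ++ u) ! (length v + t′)       ≡⟨ !-++ʳ v u t′ ⟩
    u ! t′                           ≡⟨ sym (!-++ˡ u v t′<u) ⟩
    (u ++ v) ! t′                    ≡⟨ cong (_! t′) uv≡X ⟩
    X ! t′                           ≡⟨ sym (cyc-< t′<m) ⟩
    cyc t′                           ≡⟨ sym (cyc-period t′) ⟩
    cyc (t′ + length X)              ≡⟨ cong (λ n → cyc (t′ + n)) |X| ⟩
    cyc (t′ + (length u + length v)) ≡⟨ cong cyc (rearrange t′ (length u) (length v)) ⟩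
    cyc (length u + (length v + t′)) ∎
    where
    |X| = trans (cong length (sym uv≡X)) (length-++ u)
    t′<u = +-cancelˡ-< (length v) t′ (length u)
             (subst (length v + t′ <_) (trans |X| (+-comm (length u) (length v))) t<m)
    t′<m = <-≤-trans t′<u (subst (length u ≤_) (sym |X|) (m≤m+n _ _))
    rearrange : ∀ x y z → x + (y + z) ≡ y + (z + x)
    rearrange = solve-∀

  period⇒∣ : Primitive X → ∀ {e} → Period cyc e → length X ∣ e
  period⇒∣ prim {e} per with e % length X in e%m≡
  ... | zero  = m%n≡0⇒n∣m e _ e%m≡
  ... | suc _ =
    ⊥-elim (primitive⇒rotation≢ (subst Primitive (sym uv≡X) prim) u≢[] v≢[] (trans vu≡X (sym uv≡X)))
    where
    r = e % length X
    u = take r X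
    v = drop r X
    uv≡X : u ++ v ≡ X
    uv≡X = take++drop≡id r X
    |u|≡r : length u ≡ r
    |u|≡r = trans (length-take r X) (m≤n⇒m⊓n≡m (<⇒≤ (m%n<n e (length X))))
    u≢[] : u ≢ []
    u≢[] u≡[] with () ← trans (sym e%m≡) (trans (sym |u|≡r) (cong length u≡[]))
    v≢[] : v ≢ []
    v≢[] v≡[] = <-irrefl r≡m (m%n<n e (length X))
      where
      r≡m : r ≡ length X
      r≡m = begin
        r                       ≡⟨ sym |u|≡r ⟩
        length u                ≡⟨ sym (+-identityʳ _) ⟩
        length u + 0            ≡⟨ cong (λ z → length u + length z) (sym v≡[]) ⟩
        length u + length v     ≡⟨ sym (length-++ u) ⟩
        length (u ++ v)         ≡⟨ cong length uv≡X ⟩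
        length X                ∎
    |vu|≡|X| : length (v ++ u) ≡ length X
    |vu|≡|X| = trans (length-++ v)
                 (trans (+-comm (length v) _) (trans (sym (length-++ u)) (cong length uv≡X)))
    vu≡X : v ++ u ≡ X
    vu≡X = !-ext (v ++ u) X |vu|≡|X| λ t t< → let t<m = subst (t <_) |vu|≡|X| t< in begin
      (v ++ u) ! t       ≡⟨ !-rotation u v uv≡X t t<m ⟩
      cyc (length u + t) ≡⟨ cong cyc (trans (+-comm (length u) t) (cong (t +_) |u|≡r)) ⟩
      cyc (t + r)        ≡⟨ period-% t e ⟩
      cyc (t + e)        ≡⟨ per t ⟩
      cyc t              ≡⟨ cyc-< t<m ⟩
      X ! t              ∎

module _ {A : Set} where

  SquareAt : List A → ℕ → ℕ → Set
  SquareAt w j n = ∀ t → t < n → w ! (j + n + t) ≡ w ! (j + t)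

  occursAt⇒! : ∀ {w : List A} {o} {u : List A} → OccursAt w (suc o) u → ∀ t → t < length u →
               w ! (o + t) ≡ u ! t × w ! (o + length u + t) ≡ u ! t
  occursAt⇒! {w} {o} {u} (_ , _ , v , w≡uuv) t t< = first , second
    where
    first = begin
      w ! (o + t)        ≡⟨ sym (!-drop o w t) ⟩
      drop o w ! t       ≡⟨ cong (_! t) w≡uuv ⟩
      (u ++ u ++ v) ! t  ≡⟨ !-++ˡ u _ t< ⟩
      u ! t              ∎
    second = begin
      w ! (o + length u + t)           ≡⟨ cong (w !_) (+-assoc o _ t) ⟩
      w ! (o + (length u + t))         ≡⟨ sym (!-drop o w _) ⟩
      drop o w ! (length u + t)        ≡⟨ cong (_! (length u + t)) w≡uuv ⟩
      (u ++ u ++ v) ! (length u + t)   ≡⟨ !-++ʳ u _ t ⟩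
      (u ++ v) ! t                     ≡⟨ !-++ˡ u v t< ⟩
      u ! t                            ∎

  !⇒occursAt : ∀ {w : List A} {o} {u : List A} → u ≢ [] →
               (∀ t → t < length u → w ! (o + t) ≡ u ! t) →
               (∀ t → t < length u → w ! (o + length u + t) ≡ u ! t) → OccursAt w (suc o) u
  !⇒occursAt {w} {o} {u} u≢[] first second =
    z<s , u≢[] , drop (length u) rest , trans w≡u++rest (cong (u ++_) rest≡u++)
    where
    rest = drop (length u) (drop o w)
    w≡u++rest : drop o w ≡ u ++ rest
    w≡u++rest = !-prefix u (drop o w) λ t t< → trans (!-drop o w t) (first t t<)
    rest≡u++ : rest ≡ u ++ drop (length u) rest
    rest≡u++ = !-prefix u rest λ t t< → begin
      rest ! t                  ≡⟨ !-drop (length u) _ t ⟩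
      drop o w ! (length u + t) ≡⟨ !-drop o w _ ⟩
      w ! (o + (length u + t))  ≡⟨ cong (w !_) (sym (+-assoc o _ t)) ⟩
      w ! (o + length u + t)    ≡⟨ second t t< ⟩
      u ! t                     ∎

  occursAt⇒squareAt : ∀ {w : List A} {o} {u : List A} →
                      OccursAt w (suc o) u → SquareAt w o (length u)
  occursAt⇒squareAt occ t t< = let first , second = occursAt⇒! occ t t< in trans second (sym first)

  occursAt-shift : ∀ {w : List A} {o} {u U : List A} → OccursAt w (suc o) U → OccursAt w (suc o) u →
                   length u + length u ≤ length U → OccursAt w (suc (o + length U)) u
  occursAt-shift {w} {o} {u} {U} occ-U occ-u uu≤U = !⇒occursAt (proj₁ (proj₂ occ-u)) first second
    where
    square = occursAt⇒squareAt occ-U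
    u≤U = ≤-trans (m≤m+n _ _) uu≤U
    first : ∀ t → t < length u → w ! (o + length U + t) ≡ u ! t
    first t t< = trans (square t (<-≤-trans t< u≤U)) (proj₁ (occursAt⇒! occ-u t t<))
    second : ∀ t → t < length u → w ! (o + length U + length u + t) ≡ u ! t
    second t t< = begin
      w ! (o + length U + length u + t)   ≡⟨ cong (w !_) (+-assoc (o + length U) _ t) ⟩
      w ! (o + length U + (length u + t)) ≡⟨ square (length u + t) (<-≤-trans (+-monoʳ-< _ t<) uu≤U) ⟩
      w ! (o + (length u + t))            ≡⟨ cong (w !_) (sym (+-assoc o _ t)) ⟩
      w ! (o + length u + t)              ≡⟨ proj₂ (occursAt⇒! occ-u t t<) ⟩
      u ! t                               ∎

  squareAt-run⇒period : ∀ {w : List A} {L n} → 0 < L → (∀ j → j ≤ n → SquareAt w j L) →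
                        ∀ x → x < L + n → w ! (L + x) ≡ w ! x
  squareAt-run⇒period {w} {suc L′} {n} _ square x x< with x <? suc L′
  ... | yes x<L = square 0 z≤n x x<L
  ... | no  x≮L with m≤n⇒∃[o]m+o≡n (≮⇒≥ x≮L)
  ...   | g , refl = begin
    w ! (suc L′ + (suc L′ + g)) ≡⟨ cong (w !_) (rearrange L′ g) ⟩
    w ! (suc g + suc L′ + L′)   ≡⟨ square (suc g) (+-cancelˡ-< (suc L′) g n x<) L′ (n<1+n L′) ⟩
    w ! (suc g + L′)            ≡⟨ cong (w !_) (cong suc (+-comm g L′)) ⟩
    w ! (suc L′ + g)            ∎
    where rearrange : ∀ l g → suc l + (suc l + g) ≡ suc g + suc l + l
          rearrange = solve-∀

module _ {A : Set} (_≟_ : DecidableEquality A) where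

  lcp-agrees : ∀ xs ys {t} → t < length (lcp _≟_ xs ys) → xs ! t ≡ ys ! t
  lcp-agrees (a ∷ as) (b ∷ bs) t< with a ≟ b
  lcp-agrees (a ∷ as) (b ∷ bs) {zero}  _        | yes refl = refl
  lcp-agrees (a ∷ as) (b ∷ bs) {suc t} (s<s t<) | yes refl = lcp-agrees as bs t<

  length-lcp≤ : ∀ xs ys → length (lcp _≟_ xs ys) ≤ length xs
  length-lcp≤ []       _        = z≤n
  length-lcp≤ (a ∷ as) []       = z≤n
  length-lcp≤ (a ∷ as) (b ∷ bs) with a ≟ b
  ... | yes _ = s≤s (length-lcp≤ as bs)
  ... | no  _ = z≤n

  lcp-mismatch : ∀ xs ys → length (lcp _≟_ xs ys) < length xs → length (lcp _≟_ xs ys) < length ys →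
                 xs ! length (lcp _≟_ xs ys) ≢ ys ! length (lcp _≟_ xs ys)
  lcp-mismatch (a ∷ as) (b ∷ bs) _ _ with a ≟ b
  lcp-mismatch (a ∷ as) (b ∷ bs) (s<s <as) (s<s <bs) | yes refl = lcp-mismatch as bs <as <bs
  lcp-mismatch (a ∷ as) (b ∷ bs) _         _         | no  a≢b  = a≢b ∘ just-injective

module DoubleSquareRun
  {A : Set} (_≟_ : DecidableEquality A) (w : List A) (i : ℕ) (sq SQ : ℕ → List A)
  (1≤i : 1 ≤ i)
  (two-squares : ∀ k → 1 ≤ k → k ≤ i → TwoSquaresAt w k (sq k) (SQ k))
  (same-length : ∀ k → 1 ≤ k → k ≤ i → length (SQ k) ≡ length (SQ 1))
  (x₁ x₂ : List A) (p₁ p₂ : ℕ) (x₁≢[] : x₁ ≢ []) (x₂≢[] : x₂ ≢ [])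
  (prim : Primitive (x₁ ++ x₂)) (p₂≤p₁ : p₂ ≤ p₁)
  (sq₁≡ : sq 1 ≡ ((x₁ ++ x₂) ^w p₁) ++ x₁)
  (SQ₁≡ : SQ 1 ≡ ((x₁ ++ x₂) ^w p₁) ++ x₁ ++ ((x₁ ++ x₂) ^w p₂))
  where

  X = x₁ ++ x₂
  Y = x₂ ++ x₁

  instance
    X-nonZero : NonZero (length X)
    X-nonZero = length-nonZero (proj₁ prim)

  open Cyclic X

  m = length X
  a = length x₁
  ℓ = length (lcp _≟_ X Y)
  S = p₁ * m + a
  L = S + p₂ * m

  sq-occurs : ∀ k → 1 ≤ k → k ≤ i → OccursAt w k (sq k)
  sq-occurs k 1≤k k≤i = proj₁ (proj₁ (two-squares k 1≤k k≤i))

  sq-new : ∀ k → 1 ≤ k → k ≤ i → ∀ k′ → k < k′ → ¬ OccursAt w k′ (sq k)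
  sq-new k 1≤k k≤i = proj₂ (proj₁ (two-squares k 1≤k k≤i))

  SQ-occurs : ∀ k → 1 ≤ k → k ≤ i → OccursAt w k (SQ k)
  SQ-occurs k 1≤k k≤i = proj₁ (proj₁ (proj₂ (two-squares k 1≤k k≤i)))

  |sq|<|SQ| : ∀ k → 1 ≤ k → k ≤ i → length (sq k) < length (SQ k)
  |sq|<|SQ| k 1≤k k≤i = proj₁ (proj₂ (proj₂ (two-squares k 1≤k k≤i)))

  SQ₁≡sq₁++ : SQ 1 ≡ sq 1 ++ X ^w p₂
  SQ₁≡sq₁++ = trans SQ₁≡ (trans (sym (++-assoc (X ^w p₁) x₁ _)) (cong (_++ X ^w p₂) (sym sq₁≡)))

  |sq₁|≡S : length (sq 1) ≡ S
  |sq₁|≡S = trans (cong length sq₁≡) (trans (length-++ (X ^w p₁)) (cong (_+ a) (length-^w X p₁)))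

  |SQ|≡L : ∀ k → 1 ≤ k → k ≤ i → length (SQ k) ≡ L
  |SQ|≡L k 1≤k k≤i = trans (same-length k 1≤k k≤i)
    (trans (cong length SQ₁≡sq₁++) (trans (length-++ (sq 1)) (cong₂ _+_ |sq₁|≡S (length-^w X p₂))))

  S<L : S < L
  S<L = subst₂ _<_ |sq₁|≡S (|SQ|≡L 1 ≤-refl 1≤i) (|sq|<|SQ| 1 ≤-refl 1≤i)

  1≤p₂ : 1 ≤ p₂
  1≤p₂ = positive p₂ S<L
    where positive : ∀ q → S < S + q * m → 1 ≤ q
          positive zero    S< = ⊥-elim (n≮n S (subst (S <_) (+-identityʳ S) S<))
          positive (suc _) _  = z<s

  m≤p₂m : m ≤ p₂ * m
  m≤p₂m = m≤n*m m p₂ {{>-nonZero 1≤p₂}}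

  m<S : m < S
  m<S = ≤-<-trans (m≤n*m m p₁ {{>-nonZero (≤-trans 1≤p₂ p₂≤p₁)}})
                  (m<m+n (p₁ * m) (>-nonZero⁻¹ a {{length-nonZero x₁≢[]}}))

  w≡SQ₁ : ∀ t → t < L → w ! t ≡ SQ 1 ! t
  w≡SQ₁ t t< = proj₁ (occursAt⇒! (SQ-occurs 1 ≤-refl 1≤i) t (subst (t <_) (sym |SQ₁|≡L) t<))
    where |SQ₁|≡L = |SQ|≡L 1 ≤-refl 1≤i

  w≡SQ₁′ : ∀ t → t < L → w ! (L + t) ≡ SQ 1 ! t
  w≡SQ₁′ t t< = trans (cong (λ n → w ! (n + t)) (sym |SQ₁|≡L))
    (proj₂ (occursAt⇒! (SQ-occurs 1 ≤-refl 1≤i) t (subst (t <_) (sym |SQ₁|≡L) t<)))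
    where |SQ₁|≡L = |SQ|≡L 1 ≤-refl 1≤i

  SQ₁≈cyc : ∀ t → t < S → SQ 1 ! t ≡ cyc t
  SQ₁≈cyc t t< = begin
    SQ 1 ! t               ≡⟨ cong (_! t) SQ₁≡sq₁++ ⟩
    (sq 1 ++ X ^w p₂) ! t  ≡⟨ !-++ˡ (sq 1) _ (subst (t <_) (sym |sq₁|≡S) t<) ⟩
    sq 1 ! t               ≡⟨ cong (_! t) sq₁≡ ⟩
    (X ^w p₁ ++ x₁) ! t    ≡⟨ !-^w++ p₁ x₁ x₁≈cyc t t< ⟩
    cyc t                  ∎
    where x₁≈cyc : ∀ t → t < a → x₁ ! t ≡ cyc t
          x₁≈cyc t t< = sym (trans (cyc-< (<-≤-trans t< (length-++-≤ˡ x₁))) (!-++ˡ x₁ x₂ t<))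

  SQ₁-tail≈cyc : ∀ e → e < p₂ * m → SQ 1 ! (S + e) ≡ cyc e
  SQ₁-tail≈cyc e e< = begin
    SQ 1 ! (S + e)                         ≡⟨ cong (_! (S + e)) SQ₁≡sq₁++ ⟩
    (sq 1 ++ X ^w p₂) ! (S + e)            ≡⟨ cong (λ n → (sq 1 ++ X ^w p₂) ! (n + e)) (sym |sq₁|≡S) ⟩
    (sq 1 ++ X ^w p₂) ! (length (sq 1) + e) ≡⟨ !-++ʳ (sq 1) _ e ⟩
    (X ^w p₂) ! e                          ≡⟨ !-^w p₂ e e< ⟩
    cyc e                                  ∎

  cyc-S+ : ∀ h → cyc (S + h) ≡ cyc (a + h)
  cyc-S+ h = trans (cong cyc (rearrange (p₁ * m) a h)) (period-* p₁ (a + h))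
    where rearrange : ∀ x a h → x + a + h ≡ a + h + x
          rearrange = solve-∀

  |Y|≡m : length Y ≡ m
  |Y|≡m = trans (length-++ x₂) (trans (+-comm (length x₂) a) (sym (length-++ x₁)))

  ℓ<m : ℓ < m
  ℓ<m = ≤∧≢⇒< (length-lcp≤ _≟_ X Y) λ ℓ≡m →
    primitive⇒rotation≢ prim x₁≢[] x₂≢[] (!-ext Y X |Y|≡m λ t t< →
      sym (lcp-agrees _≟_ X Y (subst (t <_) (trans |Y|≡m (sym ℓ≡m)) t<)))

  lcp-cyc : ∀ h → h < ℓ → cyc (S + h) ≡ cyc h
  lcp-cyc h h<ℓ = begin
    cyc (S + h) ≡⟨ cyc-S+ h ⟩
    cyc (a + h) ≡⟨ sym (!-rotation x₁ x₂ refl h h<m) ⟩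
    Y ! h       ≡⟨ sym (lcp-agrees _≟_ X Y h<ℓ) ⟩
    X ! h       ≡⟨ sym (cyc-< h<m) ⟩
    cyc h       ∎
    where h<m = <-trans h<ℓ ℓ<m

  mismatch : cyc (a + ℓ) ≢ cyc ℓ
  mismatch eq = lcp-mismatch _≟_ X Y ℓ<m (subst (ℓ <_) (sym |Y|≡m) ℓ<m) (begin
    X ! ℓ       ≡⟨ sym (cyc-< ℓ<m) ⟩
    cyc ℓ       ≡⟨ sym eq ⟩
    cyc (a + ℓ) ≡⟨ sym (!-rotation x₁ x₂ refl ℓ ℓ<m) ⟩
    Y ! ℓ       ∎)

  w-from-S≈cyc : ∀ e → e < L + ℓ → w ! (S + e) ≡ cyc e
  w-from-S≈cyc e e< with e <? p₂ * m
  ... | yes e<p₂m = trans (w≡SQ₁ (S + e) (+-monoʳ-< S e<p₂m)) (SQ₁-tail≈cyc e e<p₂m)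
  ... | no  e≮p₂m with m≤n⇒∃[o]m+o≡n (≮⇒≥ e≮p₂m)
  ...   | g , refl with g <? S
  ...     | yes g<S = begin
    w ! (S + (p₂ * m + g)) ≡⟨ cong (w !_) (sym (+-assoc S _ g)) ⟩
    w ! (L + g)            ≡⟨ w≡SQ₁′ g (<-trans g<S S<L) ⟩
    SQ 1 ! g               ≡⟨ SQ₁≈cyc g g<S ⟩
    cyc g                  ≡⟨ sym (period-* p₂ g) ⟩
    cyc (g + p₂ * m)       ≡⟨ cong cyc (+-comm g _) ⟩
    cyc (p₂ * m + g)       ∎
  ...     | no  g≮S with m≤n⇒∃[o]m+o≡n (≮⇒≥ g≮S)
  ...       | h , refl = begin
    w ! (S + (p₂ * m + (S + h))) ≡⟨ cong (w !_) (sym (+-assoc S _ _)) ⟩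
    w ! (L + (S + h))            ≡⟨ w≡SQ₁′ (S + h) (+-monoʳ-< S h<p₂m) ⟩
    SQ 1 ! (S + h)               ≡⟨ SQ₁-tail≈cyc h h<p₂m ⟩
    cyc h                        ≡⟨ sym (lcp-cyc h h<ℓ) ⟩
    cyc (S + h)                  ≡⟨ sym (period-* p₂ (S + h)) ⟩
    cyc (S + h + p₂ * m)         ≡⟨ cong cyc (+-comm (S + h) _) ⟩
    cyc (p₂ * m + (S + h))       ∎
    where
    rearrange : ∀ x y h → x + (y + h) ≡ y + x + h
    rearrange = solve-∀
    h<ℓ : h < ℓ
    h<ℓ = +-cancelˡ-< L h ℓ (subst (_< L + ℓ) (rearrange (p₂ * m) S h) e<)
    h<p₂m : h < p₂ * m
    h<p₂m = <-trans h<ℓ (<-≤-trans ℓ<m m≤p₂m)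

  w≈cyc : ∀ t → t < S + ℓ → w ! t ≡ cyc t
  w≈cyc t t< with t <? S
  ... | yes t<S = trans (w≡SQ₁ t (<-trans t<S S<L)) (SQ₁≈cyc t t<S)
  ... | no  t≮S with m≤n⇒∃[o]m+o≡n (≮⇒≥ t≮S)
  ...   | h , refl = trans (w-from-S≈cyc h (<-≤-trans h<ℓ (m≤n+m ℓ L))) (sym (lcp-cyc h h<ℓ))
    where h<ℓ = +-cancelˡ-< S h ℓ t<

  i≤a : p₁ ≡ p₂ → i ≤ a
  i≤a p₁≡p₂ with i ≤? a
  ... | yes i≤a = i≤a
  ... | no  i≰a = ⊥-elim (sq-new 1 ≤-refl 1≤i (suc L) (s<s 0<L)
                    (!⇒occursAt (proj₁ (proj₂ occ-sq₁)) first second))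
    where
    0<L = ≤-<-trans z≤n S<L
    occ-sq₁ = sq-occurs 1 ≤-refl 1≤i

    run : ∀ x → x < L + (i ∸ 1) → w ! (L + x) ≡ w ! x
    run = squareAt-run⇒period {w = w} 0<L λ j j≤ →
      let 1+j≤i = subst (suc j ≤_) (m+[n∸m]≡n 1≤i) (s≤s j≤) in
      subst (SquareAt w j) (|SQ|≡L (suc j) z<s 1+j≤i) (occursAt⇒squareAt (SQ-occurs (suc j) z<s 1+j≤i))

    S+S≡L+a : S + S ≡ L + a
    S+S≡L+a = trans (cong (λ p → S + (p * m + a)) p₁≡p₂) (rearrange (p₁ * m) (p₂ * m) a)
      where rearrange : ∀ x y a → x + a + (y + a) ≡ x + a + y + a
            rearrange = solve-∀

    first : ∀ t → t < length (sq 1) → w ! (L + t) ≡ sq 1 ! t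
    first t t< = trans (run t (<-≤-trans (<-trans (subst (t <_) |sq₁|≡S t<) S<L) (m≤m+n L _)))
                       (proj₁ (occursAt⇒! occ-sq₁ t t<))

    second : ∀ t → t < length (sq 1) → w ! (L + length (sq 1) + t) ≡ sq 1 ! t
    second t t< = trans (cong (w !_) (+-assoc L _ t))
                        (trans (run (length (sq 1) + t) bound) (proj₂ (occursAt⇒! occ-sq₁ t t<)))
      where
      bound : length (sq 1) + t < L + (i ∸ 1)
      bound = <-≤-trans (subst (_< L + a) (cong (_+ t) (sym |sq₁|≡S))
                          (subst (S + t <_) S+S≡L+a (+-monoʳ-< S (subst (t <_) |sq₁|≡S t<))))
                        (+-monoʳ-≤ L (∸-monoˡ-≤ 1 (≰⇒> i≰a)))

  w≈cyc-past-ℓ : ∀ t → suc t < S → w ! (suc ℓ + t) ≡ cyc (suc ℓ + t)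
  w≈cyc-past-ℓ t t< = w≈cyc (suc ℓ + t) (subst₂ _<_ (+-suc ℓ t) (+-comm ℓ S) (+-monoʳ-< ℓ t<))

  w-from-S≈cyc-past-ℓ : ∀ t → t < L → w ! (S + (ℓ + t)) ≡ cyc (ℓ + t)
  w-from-S≈cyc-past-ℓ t t< = w-from-S≈cyc (ℓ + t) (subst (ℓ + t <_) (+-comm ℓ L) (+-monoʳ-< ℓ t<))

  no-long-square : ∀ r → SquareAt w (suc ℓ) r → S ≤ r → r < L → ⊥
  no-long-square r square S≤r r<L with m≤n⇒∃[o]m+o≡n S≤r
  ... | e , refl = mismatch (begin
    cyc (a + ℓ)                ≡⟨ sym (cyc-S+ ℓ) ⟩
    cyc (S + ℓ)                ≡⟨ cong cyc (+-comm S ℓ) ⟩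
    cyc (ℓ + S)                ≡⟨ sym (period-∣ m∣e (ℓ + S)) ⟩
    cyc (ℓ + S + e)            ≡⟨ cong cyc (+-assoc ℓ S e) ⟩
    cyc (ℓ + (S + e))          ≡⟨ sym (w-from-S≈cyc-past-ℓ (S + e) r<L) ⟩
    w ! (S + (ℓ + (S + e)))    ≡⟨ cong (λ n → w ! (n + (ℓ + (S + e)))) (sym 1+S′≡S) ⟩
    w ! (suc (pred S) + (ℓ + (S + e))) ≡⟨ cong (w !_) (rearrange (pred S) ℓ (S + e)) ⟩
    w ! (suc ℓ + (S + e) + pred S) ≡⟨ square (pred S) (<-≤-trans S′<S (m≤m+n S e)) ⟩
    w ! (suc ℓ + pred S)       ≡⟨ cong (w !_) 1+ℓ+S′≡S+ℓ ⟩
    w ! (S + ℓ)                ≡⟨ w-from-S≈cyc ℓ (m<n+m ℓ (≤-<-trans z≤n S<L)) ⟩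
    cyc ℓ                      ∎)
    where
    instance
      S-nonZero : NonZero S
      S-nonZero = >-nonZero (≤-<-trans z≤n m<S)
    1+S′≡S : suc (pred S) ≡ S
    1+S′≡S = suc-pred S
    S′<S : pred S < S
    S′<S = subst (pred S <_) 1+S′≡S (n<1+n (pred S))
    1+ℓ+S′≡S+ℓ : suc ℓ + pred S ≡ S + ℓ
    1+ℓ+S′≡S+ℓ = trans (sym (+-suc ℓ _)) (trans (cong (ℓ +_) 1+S′≡S) (+-comm ℓ S))
    rearrange : ∀ S′ l r → suc S′ + (l + r) ≡ suc l + r + S′
    rearrange = solve-∀
    window : ∀ t → t < m → cyc (suc ℓ + t + e) ≡ cyc (suc ℓ + t)
    window t t<m = begin
      cyc (suc ℓ + t + e)          ≡⟨ cong cyc (shift ℓ t e) ⟩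
      cyc (ℓ + (suc t + e))        ≡⟨ sym (w-from-S≈cyc-past-ℓ (suc t + e) 1+t+e<L) ⟩
      w ! (S + (ℓ + (suc t + e)))  ≡⟨ cong (w !_) (reorder S ℓ t e) ⟩
      w ! (suc ℓ + (S + e) + t)    ≡⟨ square t (<-≤-trans (<-trans t<m m<S) (m≤m+n S e)) ⟩
      w ! (suc ℓ + t)              ≡⟨ w≈cyc-past-ℓ t 1+t<S ⟩
      cyc (suc ℓ + t)              ∎
      where
      1+t<S = ≤-<-trans t<m m<S
      1+t+e<L = <-trans (+-monoˡ-< e 1+t<S) r<L
      shift : ∀ l t e → suc l + t + e ≡ l + (suc t + e)
      shift = solve-∀
      reorder : ∀ S l t e → S + (l + (suc t + e)) ≡ suc l + (S + e) + t
      reorder = solve-∀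
    m∣e : m ∣ e
    m∣e = period⇒∣ prim (window⇒period (suc ℓ) e window)

  no-short-square : ∀ r → SquareAt w (suc ℓ) r → r < S → L < r + r → ⊥
  no-short-square r square r<S L<2r with m≤n⇒∃[o]m+o≡n r<S
  ... | e₁ , 1+r+e₁≡S = mismatch (trans (cong cyc (+-comm a ℓ)) (window⇒agree ℓ a window′))
    where
    e = suc e₁
    r+e≡S : r + e ≡ S
    r+e≡S = trans (+-suc r e₁) 1+r+e₁≡S
    e+m<r : e + m < r
    e+m<r = +-cancelˡ-< r (e + m) r (≤-<-trans r+e+m≤L L<2r)
      where r+e+m≤L = subst (_≤ L) (trans (cong (_+ m) (sym r+e≡S)) (+-assoc r e m))
                            (+-monoʳ-≤ S m≤p₂m)
    window : ∀ t → t < m → cyc (ℓ + t + e) ≡ cyc (ℓ + t)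
    window t t<m = begin
      cyc (ℓ + t + e)             ≡⟨ cong cyc (shift ℓ t e₁) ⟩
      cyc (suc ℓ + (e₁ + t))      ≡⟨ sym (w≈cyc-past-ℓ (e₁ + t) (<-trans e+t<r r<S)) ⟩
      w ! (suc ℓ + (e₁ + t))      ≡⟨ sym (square (e₁ + t) (<-trans (n<1+n _) e+t<r)) ⟩
      w ! (suc ℓ + r + (e₁ + t))  ≡⟨ cong (w !_) (trans (reorder ℓ r e₁ t) (cong (_+ (ℓ + t)) 1+r+e₁≡S)) ⟩
      w ! (S + (ℓ + t))           ≡⟨ w-from-S≈cyc-past-ℓ t (<-trans t<m (<-trans m<S S<L)) ⟩
      cyc (ℓ + t)                 ∎
      where
      e+t<r = <-trans (+-monoʳ-< e t<m) e+m<r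
      shift : ∀ l t e₁ → l + t + suc e₁ ≡ suc l + (e₁ + t)
      shift = solve-∀
      reorder : ∀ l r e₁ t → suc l + r + (e₁ + t) ≡ suc r + e₁ + (l + t)
      reorder = solve-∀
    m∣e : m ∣ e
    m∣e = period⇒∣ prim (window⇒period ℓ e window)
    window′ : ∀ t → t < m ∸ 1 → cyc (suc ℓ + t + a) ≡ cyc (suc ℓ + t)
    window′ t t< = begin
      cyc (suc ℓ + t + a)          ≡⟨ cong cyc (+-comm _ a) ⟩
      cyc (a + (suc ℓ + t))        ≡⟨ sym (cyc-S+ (suc ℓ + t)) ⟩
      cyc (S + (suc ℓ + t))        ≡⟨ cong cyc (trans (cong (_+ (suc ℓ + t)) (sym r+e≡S)) (reorder r e _ t)) ⟩
      cyc (suc ℓ + (r + t) + e)    ≡⟨ period-∣ m∣e (suc ℓ + (r + t)) ⟩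
      cyc (suc ℓ + (r + t))        ≡⟨ sym (w≈cyc-past-ℓ (r + t) 1+r+t<S) ⟩
      w ! (suc ℓ + (r + t))        ≡⟨ cong (w !_) (sym (+-assoc (suc ℓ) r t)) ⟩
      w ! (suc ℓ + r + t)          ≡⟨ square t (<-trans t<m (≤-<-trans (m≤n+m m e) e+m<r)) ⟩
      w ! (suc ℓ + t)              ≡⟨ w≈cyc-past-ℓ t (<-trans 1+t<m m<S) ⟩
      cyc (suc ℓ + t)              ∎
      where
      1+t<m : suc t < m
      1+t<m = subst (suc t <_) (suc-pred m) (s<s t<)
      t<m = <-trans (n<1+n t) 1+t<m
      1+r+t<S : suc (r + t) < S
      1+r+t<S = subst₂ _<_ (+-suc r t) r+e≡S (+-monoʳ-< r (<-≤-trans 1+t<m (∣⇒≤ m∣e)))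
      reorder : ∀ r e s t → r + e + (s + t) ≡ s + (r + t) + e
      reorder = solve-∀

  no-location-past-lcp : suc (suc ℓ) ≤ i → ⊥
  no-location-past-lcp 2+ℓ≤i = by-root-length (S ≤? r)
    where
    k = suc (suc ℓ)
    occ-u : OccursAt w k (sq k)
    occ-u = sq-occurs k z<s 2+ℓ≤i
    occ-U : OccursAt w k (SQ k)
    occ-U = SQ-occurs k z<s 2+ℓ≤i
    r = length (sq k)
    |U|≡L = |SQ|≡L k z<s 2+ℓ≤i
    square : SquareAt w (suc ℓ) r
    square = occursAt⇒squareAt {w = w} occ-u
    r<L : r < L
    r<L = subst (r <_) |U|≡L (|sq|<|SQ| k z<s 2+ℓ≤i)
    L<r+r : L < r + r
    L<r+r = ≰⇒> λ r+r≤L → sq-new k z<s 2+ℓ≤i _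
      (s<s (m<m+n (suc ℓ) (subst (0 <_) (sym |U|≡L) (≤-<-trans z≤n S<L))))
      (occursAt-shift {w = w} occ-U occ-u (subst (r + r ≤_) (sym |U|≡L) r+r≤L))
    by-root-length : Dec (S ≤ r) → ⊥
    by-root-length (yes S≤r) = no-long-square r square S≤r r<L
    by-root-length (no  S≰r) = no-short-square r square (≰⇒> S≰r) L<r+r

  i≤1+ℓ : i ≤ suc ℓ
  i≤1+ℓ with i ≤? suc ℓ
  ... | yes i≤1+ℓ = i≤1+ℓ
  ... | no  i≰1+ℓ = ⊥-elim (no-location-past-lcp (≰⇒> i≰1+ℓ))

lemma8 : {A : Set} (_≟_ : DecidableEquality A) (w : List A) (i : ℕ) (sq SQ : ℕ → List A) →
    1 ≤ i →
    (∀ k → 1 ≤ k → k ≤ i → TwoSquaresAt w k (sq k) (SQ k)) →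
    (∀ k → 1 ≤ k → k ≤ i → length (SQ k) ≡ length (SQ 1)) →
    (x₁ x₂ : List A) (p₁ p₂ : ℕ) →
    x₁ ≢ [] → x₂ ≢ [] → Primitive (x₁ ++ x₂) → p₂ ≤ p₁ →
    sq 1 ≡ ((x₁ ++ x₂) ^w p₁) ++ x₁ →
    SQ 1 ≡ ((x₁ ++ x₂) ^w p₁) ++ x₁ ++ ((x₁ ++ x₂) ^w p₂) →
    (p₂ < p₁ → i ≤ length (lcp _≟_ (x₁ ++ x₂) (x₂ ++ x₁)) + 1) ×
    (p₁ ≡ p₂ → i ≤ (length (lcp _≟_ (x₁ ++ x₂) (x₂ ++ x₁)) + 1) ⊓ length x₁)
lemma8 _≟_ w i sq SQ 1≤i two-squares same-length
       x₁ x₂ p₁ p₂ x₁≢[] x₂≢[] prim p₂≤p₁ sq₁≡ SQ₁≡ =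
  (λ _ → i≤ℓ+1) , (λ p₁≡p₂ → ⊓-glb i≤ℓ+1 (i≤a p₁≡p₂))
  where
  open DoubleSquareRun _≟_ w i sq SQ 1≤i two-squares same-length
         x₁ x₂ p₁ p₂ x₁≢[] x₂≢[] prim p₂≤p₁ sq₁≡ SQ₁≡
  i≤ℓ+1 : i ≤ ℓ + 1
  i≤ℓ+1 = subst (i ≤_) (+-comm 1 ℓ) i≤1+ℓ
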